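{- Let $k$ be a positive integer. Then $\alpha(k,2k+1)\le \frac{10k+24}{3}$ if $k\equiv0\pmod 3$, $\alpha(k,2k+1)\le\frac{10k+23}{3}$ if $k\equiv1\pmod 3$, and $\alpha(k,2k+1)\le\frac{10k+25}{3}$ if $k\equiv2\pmod 3$.
   Context: For integers $1\le k\le n$, $\alpha(k,n)$ denotes the least number of entries equal to $1$ in an $n\times n$ matrix with entries in $\{0,1\}$ in which every $k\times k$ minor (the submatrix formed by any $k$ rows and any $k$ columns) contains at least one entry equal to $1$. -}

module Defs where

open import Data.Nat using (ℕ; zero; suc; _+_; _*_; _≤_)
open import Data.Fin using (Fin)
open import Data.Bool using (Bool; true; false)
open import Data.Product using (Σ; ∃; ∃-syntax; _×_; _,_)
open import Relation.Binary.PropositionalEquality using (_≡_)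
open import Function.Definitions using (Injective)

Matrix01 : ℕ → Set
Matrix01 n = Fin n → Fin n → Bool

sumFin : (n : ℕ) → (Fin n → ℕ) → ℕ
sumFin zero    f = 0
sumFin (suc n) f = f Fin.zero + sumFin n (λ i → f (Fin.suc i))

bit : Bool → ℕ
bit true  = 1
bit false = 0

ones : (n : ℕ) → Matrix01 n → ℕ
ones n M = sumFin n (λ i → sumFin n (λ j → bit (M i j)))

EveryMinorHasOne : (k n : ℕ) → Matrix01 n → Set
EveryMinorHasOne k n M =
  (r c : Fin k → Fin n) → Injective _≡_ _≡_ r → Injective _≡_ _≡_ c →
  ∃[ i ] ∃[ j ] M (r i) (c j) ≡ true

IsAlpha : (k n a : ℕ) → Set
IsAlpha k n a =
  (Σ (Matrix01 n) λ M → EveryMinorHasOne k n M × ones n M ≡ a) ×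
  ((M : Matrix01 n) → EveryMinorHasOne k n M → a ≤ ones n M)

-- A k × k minor of M is empty only if its rows R and columns C are disjoint (M contains the identity)
-- and C contains no out-neighbour of R in the digraph with adjacency matrix M. Take for this digraph a
-- cycle on k + 4 vertices, with arcs a → a + 1 and, from every vertex whose index is divisible by 3,
-- chords a → a + 4, together with k − 3 isolated vertices: 2k + 1 vertices in all. The part X of R on
-- the cycle has between 3 and k points, so the vertex after the end of a run of X is an out-neighbour
-- outside X; if X is a single run, the chord from a vertex of index divisible by 3 among its last
-- three points gives a second one. Then R, C and these two vertices are 2k + 2 distinct vertices,
-- which is impossible. Counting ones gives 3α ≤ 10k + 21 for k ≥ 3, and explicit matrices give the
-- same bound for k = 1, 2; it implies all three bounds. The minimum α exists because
-- EveryMinorHasOne is decidable by exhaustive search.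

module Submission where

open import Defs
open import Level using (0ℓ)
open import Data.Bool using (Bool; true; false; _∨_; _∧_)
open import Data.Bool.Properties using (∨-zeroʳ) renaming (_≟_ to _≟ᵇ_)
open import Data.Empty using (⊥)
open import Data.Fin using (Fin; zero; suc; toℕ; fromℕ<; _↑ˡ_; _↑ʳ_; splitAt; join)
open import Data.Fin.Properties
  using (_≟_; any?; all?; toℕ-injective; toℕ<n; toℕ≤pred[n]; toℕ-fromℕ<; injective⇒≤; ↑ˡ-injective;
         join-splitAt; splitAt-↑ˡ; splitAt-↑ʳ; splitAt⁻¹-↑ˡ; splitAt⁻¹-↑ʳ)
open import Data.Nat using (ℕ; zero; suc; _+_; _*_; _∸_; _≤_; _<_; _%_; z≤n; s≤s) renaming (_≟_ to _≟ℕ_)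
open import Data.Nat.DivMod using (m%n<n; m<n⇒m%n≡m; [m+kn]%n≡m%n; %-distribˡ-+; m%n%n≡m%n; %-remove-+ˡ)
open import Data.Nat.Divisibility using (∣-refl)
open import Data.Nat.Properties hiding (_≟_)
open import Data.Nat.Tactic.RingSolver using (solve-∀)
open import Algebra.Properties.CommutativeSemigroup +-commutativeSemigroup using (interchange)
open import Data.Product using (∃; ∃₂; ∃-syntax; Σ; _×_; _,_; proj₁; proj₂)
open import Data.Sum using (_⊎_; inj₁; inj₂; [_,_]′)
open import Data.Vec.Functional using (_∷_; []; _++_; head; tail)
import Data.Vec.Functional.Relation.Binary.Pointwise.Properties as Pointwise
open import Function using (_∘_; id)
open import Function.Definitions using (Injective)
open import Relation.Binary.Bundles using (Setoid)
open import Relation.Binary.Definitions using (_Respects_; tri<; tri≈; tri>)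
open import Relation.Binary.PropositionalEquality
  using (_≡_; _≢_; refl; sym; trans; cong; cong₂; subst; subst₂; _≗_; setoid; module ≡-Reasoning)
open import Relation.Nullary using (Dec; yes; no; ¬_; ¬?; does; contradiction)
open import Relation.Nullary.Decidable using (map′; decidable-stable; dec-true; from-yes; _×-dec_; _→-dec_)
open import Relation.Unary using (Pred; Decidable)

sumFin-cong : ∀ n {f g : Fin n → ℕ} → f ≗ g → sumFin n f ≡ sumFin n g
sumFin-cong zero    f≗g = refl
sumFin-cong (suc n) f≗g = cong₂ _+_ (f≗g zero) (sumFin-cong n (f≗g ∘ suc))

sumFin-mono : ∀ n {f g : Fin n → ℕ} → (∀ i → f i ≤ g i) → sumFin n f ≤ sumFin n g
sumFin-mono zero    f≤g = z≤n
sumFin-mono (suc n) f≤g = +-mono-≤ (f≤g zero) (sumFin-mono n (f≤g ∘ suc))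

sumFin-+ : ∀ n (f g : Fin n → ℕ) → sumFin n (λ i → f i + g i) ≡ sumFin n f + sumFin n g
sumFin-+ zero    f g = refl
sumFin-+ (suc n) f g = trans (cong (f zero + g zero +_) (sumFin-+ n (f ∘ suc) (g ∘ suc)))
  (interchange (f zero) (g zero) (sumFin n (f ∘ suc)) (sumFin n (g ∘ suc)))

sumFin-const : ∀ n c → sumFin n (λ _ → c) ≡ n * c
sumFin-const zero    c = refl
sumFin-const (suc n) c = cong (c +_) (sumFin-const n c)

sumFin-↑ : ∀ m n (f : Fin (m + n) → ℕ) → sumFin (m + n) f ≡ sumFin m (f ∘ (_↑ˡ n)) + sumFin n (f ∘ (m ↑ʳ_))
sumFin-↑ zero    n f = refl
sumFin-↑ (suc m) n f = trans (cong (f zero +_) (sumFin-↑ m n (f ∘ suc))) (sym (+-assoc (f zero) _ _))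

sumFin-indicator : ∀ n (t : Fin n) → sumFin n (λ v → bit (does (v ≟ t))) ≡ 1
sumFin-indicator (suc n) zero    = cong suc (trans (sumFin-const n 0) (*-zeroʳ n))
sumFin-indicator (suc n) (suc t) = sumFin-indicator n t

bit-∨ : ∀ a b → bit (a ∨ b) ≤ bit a + bit b
bit-∨ true  b = s≤s z≤n
bit-∨ false b = ≤-refl

sumFin-sparse : ∀ n (g : ℕ → ℕ) → (∀ t → g t + (g (1 + t) + g (2 + t)) ≤ 1) → 3 * sumFin n (g ∘ toℕ) ≤ n + 2
sumFin-sparse zero                g sparse = z≤n
sumFin-sparse (suc zero)          g sparse =
  *-monoʳ-≤ 3 (≤-trans (≤-reflexive (+-identityʳ (g 0))) (≤-trans (m≤m+n (g 0) _) (sparse 0)))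
sumFin-sparse (suc (suc zero))    g sparse = ≤-trans (*-monoʳ-≤ 3 (begin
  g 0 + (g 1 + 0)      ≡⟨ cong (g 0 +_) (+-identityʳ (g 1)) ⟩
  g 0 + g 1            ≤⟨ +-monoʳ-≤ (g 0) (m≤m+n (g 1) (g 2)) ⟩
  g 0 + (g 1 + g 2)    ≤⟨ sparse 0 ⟩
  1                    ∎)) (n≤1+n 3)
  where open ≤-Reasoning
sumFin-sparse (suc (suc (suc n))) g sparse = begin
  3 * (g 0 + (g 1 + (g 2 + rest)))  ≡⟨ cong (λ t → 3 * (g 0 + t)) (+-assoc (g 1) (g 2) rest) ⟨
  3 * (g 0 + (g 1 + g 2 + rest))    ≡⟨ cong (3 *_) (+-assoc (g 0) (g 1 + g 2) rest) ⟨
  3 * (g 0 + (g 1 + g 2) + rest)    ≤⟨ *-monoʳ-≤ 3 (+-monoˡ-≤ rest (sparse 0)) ⟩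
  3 * (1 + rest)                    ≡⟨ *-distribˡ-+ 3 1 rest ⟩
  3 + 3 * rest                      ≤⟨ +-monoʳ-≤ 3 (sumFin-sparse n (λ t → g (3 + t)) (λ t → sparse (3 + t))) ⟩
  3 + (n + 2)                       ∎
  where
    open ≤-Reasoning
    rest = sumFin n (λ i → g (3 + toℕ i))

module _ {A : Set} where

  pigeonhole-image : ∀ {m n} {f : Fin m → A} (g : Fin n → A) →
                     Injective _≡_ _≡_ f → (∀ i → ∃ λ j → f i ≡ g j) → m ≤ n
  pigeonhole-image g f-inj f⊆g = injective⇒≤ {f = λ i → proj₁ (f⊆g i)} λ {i} {i′} eq →
    f-inj (trans (proj₂ (f⊆g i)) (trans (cong g eq) (sym (proj₂ (f⊆g i′)))))

  ∷-injective : ∀ {n} {x : A} {f : Fin n → A} → (∀ i → f i ≢ x) → Injective _≡_ _≡_ f → Injective _≡_ _≡_ (x ∷ f)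
  ∷-injective x∉f f-inj {zero}  {zero}  eq = refl
  ∷-injective x∉f f-inj {zero}  {suc j} eq = contradiction (sym eq) (x∉f j)
  ∷-injective x∉f f-inj {suc i} {zero}  eq = contradiction eq (x∉f i)
  ∷-injective x∉f f-inj {suc i} {suc j} eq = cong suc (f-inj eq)

  ++-injective : ∀ {m n} {f : Fin m → A} {g : Fin n → A} → Injective _≡_ _≡_ f → Injective _≡_ _≡_ g →
                 (∀ i j → f i ≢ g j) → Injective _≡_ _≡_ (f ++ g)
  ++-injective {m} {n} {f} {g} f-inj g-inj f∩g {i} {j} eq = begin
    i                      ≡⟨ join-splitAt m n i ⟨
    join m n (splitAt m i) ≡⟨ cong (join m n) (sides (splitAt m i) (splitAt m j) eq) ⟩
    join m n (splitAt m j) ≡⟨ join-splitAt m n j ⟩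
    j                      ∎
    where
      open ≡-Reasoning
      sides : ∀ s t → [ f , g ]′ s ≡ [ f , g ]′ t → s ≡ t
      sides (inj₁ a) (inj₁ b) eq = cong inj₁ (f-inj eq)
      sides (inj₁ a) (inj₂ b) eq = contradiction eq (f∩g a b)
      sides (inj₂ a) (inj₁ b) eq = contradiction (sym eq) (f∩g b a)
      sides (inj₂ a) (inj₂ b) eq = cong inj₂ (g-inj eq)

-- Exhaustive search and existence of α

module _ {P : Pred ℕ 0ℓ} (P? : Decidable P) where

  Least : Set
  Least = ∃ λ a → P a × (∀ {b} → P b → a ≤ b)

  least-or-none-below : ∀ t → (∀ {b} → b < t → ¬ P b) ⊎ Least
  least-or-none-below zero = inj₁ λ ()
  least-or-none-below (suc t) with least-or-none-below t
  ... | inj₂ least = inj₂ least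
  ... | inj₁ none-below with P? t
  ...   | yes pt = inj₂ (t , pt , λ pb → ≮⇒≥ λ b<t → none-below b<t pb)
  ...   | no ¬pt = inj₁ λ b<1+t → [ none-below , (λ { refl → ¬pt }) ]′ (m<1+n⇒m<n∨m≡n b<1+t)

  least-witness : ∀ {m} → P m → Least
  least-witness {m} pm =
    [ (λ none-below → contradiction pm (none-below (n<1+n m))) , id ]′ (least-or-none-below (suc m))

Searchable : Setoid 0ℓ 0ℓ → Set₁
Searchable S = ∀ {P : Pred Carrier 0ℓ} → P Respects _≈_ → Decidable P → Dec (∃ P)
  where open Setoid S

module _ (S : Setoid 0ℓ 0ℓ) where
  open Setoid S using (Carrier; _≈_) renaming (refl to ≈-refl; sym to ≈-sym)

  searchable⇒all? : Searchable S → ∀ {P : Pred Carrier 0ℓ} → P Respects _≈_ → Decidable P → Dec (∀ x → P x)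
  searchable⇒all? search resp P? with search (λ x≈y ¬px py → ¬px (resp (≈-sym x≈y) py)) (λ x → ¬? (P? x))
  ... | yes (x , ¬px) = no λ all → ¬px (all x)
  ... | no ∄¬P       = yes λ x → decidable-stable (P? x) λ ¬px → ∄¬P (x , ¬px)

  vector-searchable : Searchable S → ∀ k → Searchable (Pointwise.setoid S k)
  vector-searchable search zero resp P? with P? (λ ())
  ... | yes p = yes (_ , p)
  ... | no ¬p = no λ (xs , p) → ¬p (resp (λ ()) p)
  vector-searchable search (suc k) {P} resp P? =
    map′ (λ (x , xs , p) → x ∷ xs , p)
         (λ (xs , p) → head xs , tail xs , resp (λ { zero → ≈-refl ; (suc i) → ≈-refl }) p)
         (search resp-head (λ x → vector-searchable search k (resp-tail x) (λ xs → P? (x ∷ xs))))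
    where
      resp-head : (λ x → ∃ λ xs → P (x ∷ xs)) Respects _≈_
      resp-head x≈y (xs , p) = xs , resp (λ { zero → x≈y ; (suc i) → ≈-refl }) p
      resp-tail : ∀ x → (λ xs → P (x ∷ xs)) Respects (Setoid._≈_ (Pointwise.setoid S k))
      resp-tail x xs≋ys = resp λ { zero → ≈-refl ; (suc i) → xs≋ys i }

fin-searchable : ∀ n → Searchable (setoid (Fin n))
fin-searchable n _ = any?

bool-searchable : Searchable (setoid Bool)
bool-searchable _ P? with P? true | P? false
... | yes p | _     = yes (true , p)
... | no _  | yes p = yes (false , p)
... | no ¬t | no ¬f = no λ { (true , p) → ¬t p ; (false , p) → ¬f p }

matrix-searchable : ∀ n → Searchable (Pointwise.setoid (Pointwise.setoid (setoid Bool) n) n)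
matrix-searchable n =
  vector-searchable (Pointwise.setoid (setoid Bool) n) (vector-searchable (setoid Bool) bool-searchable n) n

injective? : ∀ {k n} (f : Fin k → Fin n) → Dec (Injective _≡_ _≡_ f)
injective? f = map′ (λ inj {x} {y} → inj x y) (λ inj x y → inj) (all? λ x → all? λ y → (f x ≟ f y) →-dec (x ≟ y))

injective-≗ : ∀ {k n} {f g : Fin k → Fin n} → f ≗ g → Injective _≡_ _≡_ f → Injective _≡_ _≡_ g
injective-≗ f≗g f-inj {x} {y} gx≡gy = f-inj (trans (f≗g x) (trans gx≡gy (sym (f≗g y))))

MinorHasOne : ∀ {k n} → Matrix01 n → (Fin k → Fin n) → (Fin k → Fin n) → Set
MinorHasOne M r c = Injective _≡_ _≡_ r → Injective _≡_ _≡_ c → ∃[ i ] ∃[ j ] M (r i) (c j) ≡ true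

everyMinorHasOne? : ∀ k n (M : Matrix01 n) → Dec (EveryMinorHasOne k n M)
everyMinorHasOne? k n M = all-maps? resp-rows λ r → all-maps? (resp-cols r) λ c →
    injective? r →-dec (injective? c →-dec any? λ i → any? λ j → M (r i) (c j) ≟ᵇ true)
  where
    all-maps? : ∀ {P : Pred (Fin k → Fin n) 0ℓ} → P Respects _≗_ → Decidable P → Dec (∀ f → P f)
    all-maps? = searchable⇒all? maps (vector-searchable (setoid (Fin n)) (fin-searchable n) k)
      where maps = Pointwise.setoid (setoid (Fin n)) k
    resp-cols : ∀ r → MinorHasOne M r Respects _≗_
    resp-cols r c≗c′ has r-inj c′-inj with has r-inj (injective-≗ (sym ∘ c≗c′) c′-inj)
    ... | i , j , hit = i , j , subst (λ v → M (r i) v ≡ true) (c≗c′ j) hit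
    resp-rows : (λ r → ∀ c → MinorHasOne M r c) Respects _≗_
    resp-rows r≗r′ has c r′-inj c-inj with has c (injective-≗ (sym ∘ r≗r′) r′-inj) c-inj
    ... | i , j , hit = i , j , subst (λ u → M u (c j) ≡ true) (r≗r′ i) hit

_≐_ : ∀ {n} → Matrix01 n → Matrix01 n → Set
M ≐ M′ = ∀ u v → M u v ≡ M′ u v

ones-cong : ∀ n {M M′ : Matrix01 n} → M ≐ M′ → ones n M ≡ ones n M′
ones-cong n M≐M′ = sumFin-cong n λ u → sumFin-cong n λ v → cong bit (M≐M′ u v)

everyMinorHasOne-cong : ∀ {k n} {M M′ : Matrix01 n} → M ≐ M′ → EveryMinorHasOne k n M → EveryMinorHasOne k n M′
everyMinorHasOne-cong M≐M′ M-valid r c r-inj c-inj with M-valid r c r-inj c-inj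
... | i , j , hit = i , j , trans (sym (M≐M′ (r i) (c j))) hit

Attained : ℕ → ℕ → Pred ℕ 0ℓ
Attained k n a = Σ (Matrix01 n) λ M → EveryMinorHasOne k n M × ones n M ≡ a

attained? : ∀ k n → Decidable (Attained k n)
attained? k n a = matrix-searchable n
  (λ M≐M′ (M-valid , ones≡a) → everyMinorHasOne-cong M≐M′ M-valid , trans (sym (ones-cong n M≐M′)) ones≡a)
  (λ M → everyMinorHasOne? k n M ×-dec (ones n M ≟ℕ a))

isAlpha-exists : ∀ {k n} (M : Matrix01 n) → EveryMinorHasOne k n M → ∃ λ a → IsAlpha k n a × a ≤ ones n M
isAlpha-exists {k} {n} M M-valid with least-witness (attained? k n) (M , M-valid , refl)
... | a , attained , least =
  a , (attained , λ M′ M′-valid → least (M′ , M′-valid , refl)) , least (M , M-valid , refl)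

-- Taking the witness apart here rather than at the call sites keeps Agda from normalising it at
-- concrete sizes, which would run the exhaustive search.
isAlpha-scale : ∀ t {k n b c} → (∃ λ a → IsAlpha k n a × a ≤ b) → t * b ≤ c → ∃ λ a → IsAlpha k n a × t * a ≤ c
isAlpha-scale t (a , isAlpha , a≤b) tb≤c = a , isAlpha , ≤-trans (*-monoʳ-≤ t a≤b) tb≤c

-- Rotations of a cycle

module Rotation (n₀ : ℕ) where
  open ≡-Reasoning

  n : ℕ
  n = suc n₀

  rotate : ℕ → Fin n → Fin n
  rotate m x = fromℕ< (m%n<n (toℕ x + m) n)

  toℕ-rotate : ∀ m x → toℕ (rotate m x) ≡ (toℕ x + m) % n
  toℕ-rotate m x = toℕ-fromℕ< (m%n<n (toℕ x + m) n)

  private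
    toℕ%n : ∀ (x : Fin n) → toℕ x % n ≡ toℕ x
    toℕ%n x = m<n⇒m%n≡m (toℕ<n x)

    %-absorbˡ : ∀ a b → (a % n + b) % n ≡ (a + b) % n
    %-absorbˡ a b = begin
      (a % n + b) % n          ≡⟨ %-distribˡ-+ (a % n) b n ⟩
      (a % n % n + b % n) % n  ≡⟨ cong (λ t → (t + b % n) % n) (m%n%n≡m%n a n) ⟩
      (a % n + b % n) % n      ≡⟨ %-distribˡ-+ a b n ⟨
      (a + b) % n              ∎

  rotate-zero : ∀ x → rotate 0 x ≡ x
  rotate-zero x = toℕ-injective (begin
    toℕ (rotate 0 x)  ≡⟨ toℕ-rotate 0 x ⟩
    (toℕ x + 0) % n   ≡⟨ cong (_% n) (+-identityʳ (toℕ x)) ⟩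
    toℕ x % n         ≡⟨ toℕ%n x ⟩
    toℕ x             ∎)

  rotate-+ : ∀ m m′ x → rotate m (rotate m′ x) ≡ rotate (m′ + m) x
  rotate-+ m m′ x = toℕ-injective (begin
    toℕ (rotate m (rotate m′ x))   ≡⟨ toℕ-rotate m (rotate m′ x) ⟩
    (toℕ (rotate m′ x) + m) % n    ≡⟨ cong (λ t → (t + m) % n) (toℕ-rotate m′ x) ⟩
    ((toℕ x + m′) % n + m) % n     ≡⟨ %-absorbˡ (toℕ x + m′) m ⟩
    (toℕ x + m′ + m) % n           ≡⟨ cong (_% n) (+-assoc (toℕ x) m′ m) ⟩
    (toℕ x + (m′ + m)) % n         ≡⟨ toℕ-rotate (m′ + m) x ⟨
    toℕ (rotate (m′ + m) x)        ∎)

  rotate-suc : ∀ m x → rotate 1 (rotate m x) ≡ rotate (suc m) x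
  rotate-suc m x = trans (rotate-+ 1 m x) (cong (λ t → rotate t x) (+-comm m 1))

  rotate-comm : ∀ m m′ x → rotate m (rotate m′ x) ≡ rotate m′ (rotate m x)
  rotate-comm m m′ x = begin
    rotate m (rotate m′ x)  ≡⟨ rotate-+ m m′ x ⟩
    rotate (m′ + m) x       ≡⟨ cong (λ t → rotate t x) (+-comm m′ m) ⟩
    rotate (m + m′) x       ≡⟨ rotate-+ m′ m x ⟨
    rotate m′ (rotate m x)  ∎

  rotate-multiple : ∀ m x → rotate (m * n) x ≡ x
  rotate-multiple m x = toℕ-injective (trans (toℕ-rotate (m * n) x) (trans ([m+kn]%n≡m%n (toℕ x) m n) (toℕ%n x)))

  rotate-injective : ∀ m {x y} → rotate m x ≡ rotate m y → x ≡ y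
  rotate-injective m {x} {y} eq = begin
    x                               ≡⟨ inverse x ⟨
    rotate (m * n₀) (rotate m x)    ≡⟨ cong (rotate (m * n₀)) eq ⟩
    rotate (m * n₀) (rotate m y)    ≡⟨ inverse y ⟩
    y                               ∎
    where
      inverse : ∀ x → rotate (m * n₀) (rotate m x) ≡ x
      inverse x = begin
        rotate (m * n₀) (rotate m x)  ≡⟨ rotate-+ (m * n₀) m x ⟩
        rotate (m + m * n₀) x         ≡⟨ cong (λ t → rotate t x) (*-suc m n₀) ⟨
        rotate (m * n) x              ≡⟨ rotate-multiple m x ⟩
        x                             ∎

  rotate-reach : ∀ x y → ∃ λ d → rotate d y ≡ x
  rotate-reach x y = n ∸ toℕ y + toℕ x , toℕ-injective (begin
    toℕ (rotate (n ∸ toℕ y + toℕ x) y)      ≡⟨ toℕ-rotate (n ∸ toℕ y + toℕ x) y ⟩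
    (toℕ y + (n ∸ toℕ y + toℕ x)) % n       ≡⟨ cong (_% n) (+-assoc (toℕ y) (n ∸ toℕ y) (toℕ x)) ⟨
    (toℕ y + (n ∸ toℕ y) + toℕ x) % n       ≡⟨ cong (λ t → (t + toℕ x) % n) (m+[n∸m]≡n (<⇒≤ (toℕ<n y))) ⟩
    (n + toℕ x) % n                         ≡⟨ %-remove-+ˡ (toℕ x) ∣-refl ⟩
    toℕ x % n                               ≡⟨ toℕ%n x ⟩
    toℕ x                                   ∎)

  -- A rotation fixing one point fixes all, in particular zero, whose image has index m % n.
  rotate-fixed : ∀ {m x} → m < n → rotate m x ≡ x → m ≡ 0
  rotate-fixed {m} {x} m<n fixed with rotate-reach zero x
  ... | d , x↦zero = begin
    m                            ≡⟨ m<n⇒m%n≡m m<n ⟨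
    m % n                        ≡⟨ toℕ-rotate m zero ⟨
    toℕ (rotate m zero)          ≡⟨ cong (toℕ ∘ rotate m) x↦zero ⟨
    toℕ (rotate m (rotate d x))  ≡⟨ cong toℕ (rotate-comm m d x) ⟩
    toℕ (rotate d (rotate m x))  ≡⟨ cong (toℕ ∘ rotate d) fixed ⟩
    toℕ (rotate d x)             ≡⟨ cong toℕ x↦zero ⟩
    0                            ∎

  rotate-distinct : ∀ {m m′} x → m < m′ → m′ ∸ m < n → rotate m x ≢ rotate m′ x
  rotate-distinct {m} {m′} x m<m′ m′∸m<n eq = <⇒≢ (m<n⇒0<n∸m m<m′) (sym (rotate-fixed m′∸m<n (begin
    rotate (m′ ∸ m) (rotate m x)  ≡⟨ rotate-+ (m′ ∸ m) m x ⟩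
    rotate (m + (m′ ∸ m)) x       ≡⟨ cong (λ t → rotate t x) (m+[n∸m]≡n (<⇒≤ m<m′)) ⟩
    rotate m′ x                   ≡⟨ eq ⟨
    rotate m x                    ∎)))

  rotate-injectiveˡ : ∀ {m m′} x → m < n → m′ < n → rotate m x ≡ rotate m′ x → m ≡ m′
  rotate-injectiveˡ {m} {m′} x m<n m′<n eq with <-cmp m m′
  ... | tri< m<m′ _ _ = contradiction eq (rotate-distinct x m<m′ (≤-<-trans (m∸n≤m m′ m) m′<n))
  ... | tri≈ _ m≡m′ _ = m≡m′
  ... | tri> _ _ m′<m = contradiction (sym eq) (rotate-distinct x m′<m (≤-<-trans (m∸n≤m m m′) m<n))

  rotate-back : ∀ m x → m ≤ toℕ x → ∃ λ u → toℕ u ≡ toℕ x ∸ m × rotate m u ≡ x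
  rotate-back m x m≤x = u , toℕ-fromℕ< x∸m<n , toℕ-injective (begin
    toℕ (rotate m u)    ≡⟨ toℕ-rotate m u ⟩
    (toℕ u + m) % n     ≡⟨ cong (λ t → (t + m) % n) (toℕ-fromℕ< x∸m<n) ⟩
    (toℕ x ∸ m + m) % n ≡⟨ cong (_% n) (m∸n+n≡m m≤x) ⟩
    toℕ x % n           ≡⟨ toℕ%n x ⟩
    toℕ x               ∎)
    where
      x∸m<n : toℕ x ∸ m < n
      x∸m<n = ≤-<-trans (m∸n≤m (toℕ x) m) (toℕ<n x)
      u : Fin n
      u = fromℕ< x∸m<n

-- Out-neighbours of a set of vertices of the chorded cycle

Covers : ∀ {A : Set} {m} → (Fin m → A) → Pred A 0ℓ → Set
Covers g X = ∀ a → X a → ∃ λ j → a ≡ g j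

module CycleWithChords (k : ℕ) (marked : Fin (4 + k) → Bool)
  (marked-nearby : ∀ x → ∃ λ m → m ≤ 2 × ∃ λ u → Rotation.rotate (3 + k) m u ≡ x × marked u ≡ true) where

  open Rotation (3 + k)

  Arc : Fin n → Fin n → Set
  Arc a b = b ≡ rotate 1 a ⊎ (marked a ≡ true × b ≡ rotate 4 a)

  Exit : Pred (Fin n) 0ℓ → Fin n → Set
  Exit X e = ¬ X e × ∃ λ a → X a × Arc a e

  -- X has at least three and at most k points.
  module _ {X : Pred (Fin n) 0ℓ} (X? : Decidable X)
    (X-large : ∀ (g : Fin 2 → Fin n) → ¬ Covers g X)
    (X-small : ∀ (g : Fin (suc k) → Fin n) → Injective _≡_ _≡_ g → ¬ (∀ l → X (g l))) where

    no-long-run : ∀ a → ¬ (∀ l → l ≤ k → X (rotate l a))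
    no-long-run a run = X-small (λ l → rotate (toℕ l) a) iterates-injective (λ l → run (toℕ l) (toℕ≤pred[n] l))
      where
        l<n : ∀ (l : Fin (suc k)) → toℕ l < n
        l<n l = <-≤-trans (toℕ<n l) (m≤n+m (suc k) 3)
        iterates-injective : Injective _≡_ _≡_ (λ (l : Fin (suc k)) → rotate (toℕ l) a)
        iterates-injective {l} {l′} eq = toℕ-injective (rotate-injectiveˡ a (l<n l) (l<n l′) eq)

    run-end-exit : ∀ a → X a → ¬ X (rotate 1 a) → Exit X (rotate 1 a)
    run-end-exit a a∈X a⁺∉X = a⁺∉X , a , a∈X , inj₁ refl

    not-rotation-closed : ¬ (∀ a → X a → X (rotate 1 a))
    not-rotation-closed closed with any? X?
    ... | no ∄X = X-large (λ _ → zero) (λ a a∈X → contradiction (a , a∈X) ∄X)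
    ... | yes (a , a∈X) = no-long-run a (λ l _ → orbit l)
      where
        orbit : ∀ l → X (rotate l a)
        orbit zero    = subst X (sym (rotate-zero a)) a∈X
        orbit (suc l) = subst X (rotate-suc l a) (closed _ (orbit l))

    -- X is a single run of consecutive points ending at x.
    module Run (x : Fin n) (x∈X : X x) (continues : ∀ a → X a → a ≢ x → X (rotate 1 a)) where

      gap : ∀ m → 0 < m → m ≤ 4 → ¬ X (rotate m x)
      gap m 0<m m≤4 xₘ∈X = no-long-run (rotate m x) run
        where
          run : ∀ l → l ≤ k → X (rotate l (rotate m x))
          run zero    _     = subst X (sym (rotate-zero (rotate m x))) xₘ∈X
          run (suc l) 1+l≤k = subst X (rotate-suc l (rotate m x)) (continues _ (run l (≤-trans (n≤1+n l) 1+l≤k)) ≢x)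
            where
              ≢x : rotate l (rotate m x) ≢ x
              ≢x eq = <⇒≢ (≤-trans 0<m (m≤m+n m l))
                (sym (rotate-fixed (+-mono-≤-< m≤4 1+l≤k) (trans (sym (rotate-+ l m x)) eq)))

      run-after : ∀ {m u} → ¬ X u → rotate m u ≡ x →
                  ∀ d a → X a → rotate d a ≡ x → ∃ λ j → j < m × a ≡ rotate (suc j) u
      run-after {m} {u} u∉X u↦x = walk
        where
          at-x : ∀ m → rotate m u ≡ x → ∀ {a} → X a → a ≡ x → ∃ λ j → j < m × a ≡ rotate (suc j) u
          at-x zero    u↦x a∈X a≡x = contradiction (subst X (trans a≡x (trans (sym u↦x) (rotate-zero u))) a∈X) u∉X
          at-x (suc j) u↦x a∈X a≡x = j , ≤-refl , trans a≡x (sym u↦x)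
          walk : ∀ d a → X a → rotate d a ≡ x → ∃ λ j → j < m × a ≡ rotate (suc j) u
          walk zero a a∈X a↦x = at-x m u↦x a∈X (trans (sym (rotate-zero a)) a↦x)
          walk (suc d) a a∈X a↦x with a ≟ x
          ... | yes a≡x = at-x m u↦x a∈X a≡x
          ... | no a≢x with walk d (rotate 1 a) (continues a a∈X a≢x) (trans (rotate-+ d 1 a) a↦x)
          ...   | zero  , _     , a⁺≡u⁺ = contradiction (subst X (rotate-injective 1 a⁺≡u⁺) a∈X) u∉X
          ...   | suc j , 1+j<m , a⁺≡u⁺⁺ =
                  j , <-trans (n<1+n j) 1+j<m , rotate-injective 1 (trans a⁺≡u⁺⁺ (sym (rotate-suc (suc j) u)))

      -- A marked u among x, x − 1, x − 2 lies in X, as otherwise X ⊆ {u + 1, u + 2}; its chord ends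
      -- in the gap after x.
      chord-exit : ∃ λ m → 2 ≤ m × m ≤ 4 × Exit X (rotate m x)
      chord-exit with marked-nearby x
      ... | m , m≤2 , u , u↦x , u-marked with X? u
      ...   | no u∉X = contradiction cover (X-large (rotate 1 u ∷ rotate 2 u ∷ []))
        where
          cover : Covers (rotate 1 u ∷ rotate 2 u ∷ []) X
          cover a a∈X with rotate-reach x a
          ... | d , a↦x with run-after u∉X u↦x d a a∈X a↦x
          ...   | zero          , _   , a≡u⁺  = zero , a≡u⁺
          ...   | suc zero      , _   , a≡u⁺⁺ = suc zero , a≡u⁺⁺
          ...   | suc (suc j) , 3+j<m , _     = contradiction (≤-trans 3+j<m m≤2) λ { (s≤s (s≤s ())) }
      ...   | yes u∈X =
              4 ∸ m , 2≤4∸m , m∸n≤m 4 m , gap (4 ∸ m) (≤-trans (s≤s z≤n) 2≤4∸m) (m∸n≤m 4 m) ,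
              u , u∈X , inj₂ (u-marked , chord)
        where
          open ≡-Reasoning
          2≤4∸m : 2 ≤ 4 ∸ m
          2≤4∸m = ∸-monoʳ-≤ 4 m≤2
          chord : rotate (4 ∸ m) x ≡ rotate 4 u
          chord = begin
            rotate (4 ∸ m) x             ≡⟨ cong (rotate (4 ∸ m)) u↦x ⟨
            rotate (4 ∸ m) (rotate m u)  ≡⟨ rotate-+ (4 ∸ m) m u ⟩
            rotate (m + (4 ∸ m)) u       ≡⟨ cong (λ t → rotate t u) (m+[n∸m]≡n (m≤n⇒m≤o+n 2 m≤2)) ⟩
            rotate 4 u                   ∎

    two-exits : ∃₂ λ e₁ e₂ → e₁ ≢ e₂ × Exit X e₁ × Exit X e₂
    two-exits with any? (λ a → X? a ×-dec ¬? (X? (rotate 1 a)))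
    ... | no ∄end =
          contradiction (λ a a∈X → decidable-stable (X? (rotate 1 a)) λ a⁺∉X → ∄end (a , a∈X , a⁺∉X))
                        not-rotation-closed
    ... | yes (x , x∈X , x⁺∉X) with any? (λ a → (X? a ×-dec ¬? (X? (rotate 1 a))) ×-dec ¬? (a ≟ x))
    ...   | yes (y , (y∈X , y⁺∉X) , y≢x) =
            rotate 1 x , rotate 1 y , (λ eq → y≢x (sym (rotate-injective 1 eq))) ,
            run-end-exit x x∈X x⁺∉X , run-end-exit y y∈X y⁺∉X
    ...   | no ∄end′ with Run.chord-exit x x∈X continues
      where
        continues : ∀ a → X a → a ≢ x → X (rotate 1 a)
        continues a a∈X a≢x = decidable-stable (X? (rotate 1 a)) λ a⁺∉X → ∄end′ (a , (a∈X , a⁺∉X) , a≢x)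
    ...     | m , 2≤m , m≤4 , exit =
              rotate 1 x , rotate m x , rotate-distinct x 2≤m (≤-<-trans (∸-monoˡ-≤ 1 m≤4) (m≤m+n 4 k)) ,
              run-end-exit x x∈X x⁺∉X , exit

-- The matrices

multipleOf3 : ℕ → Bool
multipleOf3 0                   = true
multipleOf3 1                   = false
multipleOf3 2                   = false
multipleOf3 (suc (suc (suc t))) = multipleOf3 t

multipleOf3-window : ∀ t → bit (multipleOf3 t) + (bit (multipleOf3 (1 + t)) + bit (multipleOf3 (2 + t))) ≤ 1
multipleOf3-window 0 = ≤-refl
multipleOf3-window 1 = ≤-refl
multipleOf3-window 2 = ≤-refl
multipleOf3-window (suc (suc (suc t))) = multipleOf3-window t

multipleOf3-below : ∀ t → ∃ λ m → m ≤ 2 × m ≤ t × multipleOf3 (t ∸ m) ≡ true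
multipleOf3-below 0 = 0 , z≤n , z≤n , refl
multipleOf3-below 1 = 1 , s≤s z≤n , ≤-refl , refl
multipleOf3-below 2 = 2 , ≤-refl , ≤-refl , refl
multipleOf3-below (suc (suc (suc t))) with multipleOf3-below t
... | m , m≤2 , m≤t , marked = m , m≤2 , m≤n⇒m≤o+n 3 m≤t , trans (cong multipleOf3 (+-∸-assoc 3 m≤t)) marked

module CycleMatrix (z : ℕ) where

  k : ℕ
  k = 3 + z

  open Rotation (3 + k)

  N : ℕ
  N = n + z

  vertex : Fin n → Fin N
  vertex a = a ↑ˡ z

  marked : Fin n → Bool
  marked a = multipleOf3 (toℕ a)

  marked-nearby : ∀ x → ∃ λ m → m ≤ 2 × ∃ λ u → rotate m u ≡ x × marked u ≡ true
  marked-nearby x with multipleOf3-below (toℕ x)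
  ... | m , m≤2 , m≤x , x∸m-marked with rotate-back m x m≤x
  ...   | u , u≡x∸m , u↦x = m , m≤2 , u , u↦x , trans (cong multipleOf3 u≡x∸m) x∸m-marked

  open CycleWithChords k marked marked-nearby

  arcs-from : Fin n ⊎ Fin z → Fin N → Bool
  arcs-from (inj₁ a) v = does (v ≟ vertex (rotate 1 a)) ∨ (marked a ∧ does (v ≟ vertex (rotate 4 a)))
  arcs-from (inj₂ _) v = false

  M : Matrix01 N
  M u v = does (v ≟ u) ∨ arcs-from (splitAt n u) v

  M-diagonal : ∀ u → M u u ≡ true
  M-diagonal u rewrite dec-true (u ≟ u) refl = refl

  arcs-from-arc : ∀ {a b} → Arc a b → arcs-from (inj₁ a) (vertex b) ≡ true
  arcs-from-arc {a} (inj₁ refl) rewrite dec-true (vertex (rotate 1 a) ≟ vertex (rotate 1 a)) refl = refl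
  arcs-from-arc {a} (inj₂ (a-marked , refl))
    rewrite a-marked | dec-true (vertex (rotate 4 a) ≟ vertex (rotate 4 a)) refl = ∨-zeroʳ _

  M-arc : ∀ {a b} → Arc a b → M (vertex a) (vertex b) ≡ true
  M-arc {a} {b} arc = begin
    M (vertex a) (vertex b)               ≡⟨ cong (λ s → loop ∨ arcs-from s (vertex b)) (splitAt-↑ˡ n a z) ⟩
    loop ∨ arcs-from (inj₁ a) (vertex b)  ≡⟨ cong (loop ∨_) (arcs-from-arc {a} arc) ⟩
    loop ∨ true                           ≡⟨ ∨-zeroʳ loop ⟩
    true                                  ∎
    where
      open ≡-Reasoning
      loop = does (vertex b ≟ vertex a)

  module _ {r c : Fin k → Fin N} (r-inj : Injective _≡_ _≡_ r) (c-inj : Injective _≡_ _≡_ c)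
    (minor-empty : ∀ i j → M (r i) (c j) ≢ true) where

    InRows : Pred (Fin n) 0ℓ
    InRows a = ∃ λ i → r i ≡ vertex a

    inRows? : Decidable InRows
    inRows? a = any? λ i → r i ≟ vertex a

    inRows-large : ∀ (g : Fin 2 → Fin n) → ¬ Covers g InRows
    inRows-large g cover = 1+n≰n (pigeonhole-image G r-inj row-in-G)
      where
        G : Fin (2 + z) → Fin N
        G = vertex (g zero) ∷ vertex (g (suc zero)) ∷ (n ↑ʳ_)
        row-in-G : ∀ i → ∃ λ j → r i ≡ G j
        row-in-G i with splitAt n (r i) in split
        ... | inj₂ b = suc (suc b) , sym (splitAt⁻¹-↑ʳ split)
        ... | inj₁ a with cover a (i , sym (splitAt⁻¹-↑ˡ split))
        ...   | zero     , a≡g₀ = zero     , trans (sym (splitAt⁻¹-↑ˡ split)) (cong vertex a≡g₀)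
        ...   | suc zero , a≡g₁ = suc zero , trans (sym (splitAt⁻¹-↑ˡ split)) (cong vertex a≡g₁)
        ...   | suc (suc ()) , _

    inRows-small : ∀ (g : Fin (suc k) → Fin n) → Injective _≡_ _≡_ g → ¬ (∀ l → InRows (g l))
    inRows-small g g-inj in-rows =
      1+n≰n (pigeonhole-image r (λ eq → g-inj (↑ˡ-injective z _ _ eq)) λ l → let i , eq = in-rows l in i , sym eq)

    exit-outside : ∀ {e} → Exit InRows e → (∀ i → r i ≢ vertex e) × (∀ j → c j ≢ vertex e)
    exit-outside (e∉rows , a , (i , rᵢ≡a) , arc) =
      (λ i′ eq → e∉rows (i′ , eq)) ,
      (λ j eq → minor-empty i j (subst₂ (λ u v → M u v ≡ true) (sym rᵢ≡a) (sym eq) (M-arc arc)))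

    -- Rows, columns and the two exits are 2k + 2 distinct vertices among 2k + 1.
    no-empty-minor : ⊥
    no-empty-minor with two-exits inRows? inRows-large inRows-small
    ... | e₁ , e₂ , e₁≢e₂ , exit₁ , exit₂ = 1+n≰n (subst (_≤ N) (size z) (injective⇒≤ injective))
      where
        outside₁ = exit-outside exit₁
        outside₂ = exit-outside exit₂
        size : ∀ z → (2 + (3 + z)) + (3 + z) ≡ suc (7 + z + z)
        size = solve-∀
        injective : Injective _≡_ _≡_ ((vertex e₁ ∷ vertex e₂ ∷ r) ++ c)
        injective = ++-injective
          (∷-injective (λ { zero eq → e₁≢e₂ (↑ˡ-injective z _ _ (sym eq)) ; (suc i) → proj₁ outside₁ i })
            (∷-injective (proj₁ outside₂) r-inj))
          c-inj
          λ { zero j eq → proj₂ outside₁ j (sym eq)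
            ; (suc zero) j eq → proj₂ outside₂ j (sym eq)
            ; (suc (suc i)) j eq → minor-empty i j (subst (λ v → M (r i) v ≡ true) eq (M-diagonal (r i))) }

  M-valid : EveryMinorHasOne k N M
  M-valid r c r-inj c-inj =
    decidable-stable (any? λ i → any? λ j → M (r i) (c j) ≟ᵇ true) λ no-one →
      no-empty-minor r-inj c-inj λ i j hit → no-one (i , j , hit)

  arcs-count : Fin n ⊎ Fin z → ℕ
  arcs-count (inj₁ a) = 1 + bit (marked a)
  arcs-count (inj₂ _) = 0

  private
    sumFin-zero : ∀ m → sumFin m (λ _ → 0) ≡ 0
    sumFin-zero m = trans (sumFin-const m 0) (*-zeroʳ m)

    sumFin-one : ∀ m → sumFin m (λ _ → 1) ≡ m
    sumFin-one m = trans (sumFin-const m 1) (*-identityʳ m)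

  arcs-from-row : ∀ s → sumFin N (λ v → bit (arcs-from s v)) ≤ arcs-count s
  arcs-from-row (inj₂ _) = ≤-reflexive (sumFin-zero N)
  arcs-from-row (inj₁ a) = begin
    sumFin N (λ v → bit (step v ∨ (marked a ∧ chord v)))
      ≤⟨ sumFin-mono N (λ v → bit-∨ (step v) (marked a ∧ chord v)) ⟩
    sumFin N (λ v → bit (step v) + bit (marked a ∧ chord v))
      ≡⟨ sumFin-+ N (bit ∘ step) (λ v → bit (marked a ∧ chord v)) ⟩
    sumFin N (bit ∘ step) + sumFin N (λ v → bit (marked a ∧ chord v))
      ≡⟨ cong₂ _+_ (sumFin-indicator N (vertex (rotate 1 a))) (chords (marked a)) ⟩
    1 + bit (marked a)
      ∎
    where
      open ≤-Reasoning
      step chord : Fin N → Bool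
      step v = does (v ≟ vertex (rotate 1 a))
      chord v = does (v ≟ vertex (rotate 4 a))
      chords : ∀ b → sumFin N (λ v → bit (b ∧ chord v)) ≡ bit b
      chords true  = sumFin-indicator N (vertex (rotate 4 a))
      chords false = sumFin-zero N

  M-row : ∀ u → sumFin N (λ v → bit (M u v)) ≤ 1 + arcs-count (splitAt n u)
  M-row u = begin
    sumFin N (λ v → bit (loop v ∨ arcs v))         ≤⟨ sumFin-mono N (λ v → bit-∨ (loop v) (arcs v)) ⟩
    sumFin N (λ v → bit (loop v) + bit (arcs v))   ≡⟨ sumFin-+ N (bit ∘ loop) (bit ∘ arcs) ⟩
    sumFin N (bit ∘ loop) + sumFin N (bit ∘ arcs)  ≡⟨ cong (_+ sumFin N (bit ∘ arcs)) (sumFin-indicator N u) ⟩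
    1 + sumFin N (bit ∘ arcs)                      ≤⟨ +-monoʳ-≤ 1 (arcs-from-row (splitAt n u)) ⟩
    1 + arcs-count (splitAt n u)                   ∎
    where
      open ≤-Reasoning
      loop arcs : Fin N → Bool
      loop v = does (v ≟ u)
      arcs = arcs-from (splitAt n u)

  markedCount : ℕ
  markedCount = sumFin n (bit ∘ marked)

  ones-M : ones N M ≤ N + (n + markedCount)
  ones-M = begin
    ones N M                                                ≤⟨ sumFin-mono N M-row ⟩
    sumFin N (λ u → 1 + arcs-count (splitAt n u))          ≡⟨ sumFin-+ N (λ _ → 1) (arcs-count ∘ splitAt n) ⟩
    sumFin N (λ _ → 1) + sumFin N (arcs-count ∘ splitAt n)  ≡⟨ cong₂ _+_ (sumFin-one N) all-arcs ⟩
    N + (n + markedCount)                                   ∎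
    where
      open ≤-Reasoning
      all-arcs : sumFin N (arcs-count ∘ splitAt n) ≡ n + markedCount
      all-arcs = begin-equality
        sumFin N (arcs-count ∘ splitAt n)
          ≡⟨ sumFin-↑ n z (arcs-count ∘ splitAt n) ⟩
        sumFin n (arcs-count ∘ splitAt n ∘ vertex) + sumFin z (arcs-count ∘ splitAt n ∘ (n ↑ʳ_))
          ≡⟨ cong₂ _+_ (sumFin-cong n λ a → cong arcs-count (splitAt-↑ˡ n a z))
                       (sumFin-cong z λ b → cong arcs-count (splitAt-↑ʳ n z b)) ⟩
        sumFin n (λ a → 1 + bit (marked a)) + sumFin z (λ _ → 0)
          ≡⟨ cong₂ _+_ (sumFin-+ n (λ _ → 1) (bit ∘ marked)) (sumFin-zero z) ⟩
        sumFin n (λ _ → 1) + markedCount + 0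
          ≡⟨ trans (+-identityʳ _) (cong (_+ markedCount) (sumFin-one n)) ⟩
        n + markedCount
          ∎

  ones-M-bound : 3 * ones N M ≤ 10 * k + 21
  ones-M-bound = begin
    3 * ones N M                      ≤⟨ *-monoʳ-≤ 3 ones-M ⟩
    3 * (N + (n + markedCount))       ≡⟨ distribute z markedCount ⟩
    3 * N + 3 * n + 3 * markedCount   ≤⟨ +-monoʳ-≤ (3 * N + 3 * n) marked-sparse ⟩
    3 * N + 3 * n + (n + 2)           ≡⟨ collect z ⟩
    10 * k + 21                       ∎
    where
      open ≤-Reasoning
      marked-sparse : 3 * markedCount ≤ n + 2
      marked-sparse = sumFin-sparse n (bit ∘ multipleOf3) multipleOf3-window
      distribute : ∀ z m → 3 * ((7 + z) + z + ((7 + z) + m)) ≡ 3 * ((7 + z) + z) + 3 * (7 + z) + 3 * m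
      distribute = solve-∀
      collect : ∀ z → 3 * ((7 + z) + z) + 3 * (7 + z) + ((7 + z) + 2) ≡ 10 * (3 + z) + 21
      collect = solve-∀

  N≡2k+1 : N ≡ 2 * k + 1
  N≡2k+1 = arithmetic z
    where
      arithmetic : ∀ z → 7 + z + z ≡ 2 * (3 + z) + 1
      arithmetic = solve-∀

  alpha-bound-cycle : ∃ λ a → IsAlpha k N a × 3 * a ≤ 10 * k + 21
  alpha-bound-cycle = isAlpha-scale 3 (isAlpha-exists M M-valid) ones-M-bound

private
  O I : Bool
  O = false
  I = true

matrix₅ : Matrix01 5
matrix₅ = (O ∷ O ∷ I ∷ I ∷ I ∷ [])
        ∷ (O ∷ I ∷ O ∷ I ∷ I ∷ [])
        ∷ (I ∷ O ∷ I ∷ O ∷ I ∷ [])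
        ∷ (O ∷ I ∷ I ∷ O ∷ O ∷ [])
        ∷ (I ∷ O ∷ O ∷ I ∷ O ∷ [])
        ∷ []

alpha-bound : ∀ k → 1 ≤ k → ∃ λ a → IsAlpha k (2 * k + 1) a × 3 * a ≤ 10 * k + 21
alpha-bound 1 _ =
  isAlpha-scale 3 (isAlpha-exists {1} {3} (λ _ _ → true) (λ _ _ _ _ → zero , zero , refl)) (m≤m+n 27 4)
alpha-bound 2 _ =
  isAlpha-scale 3 (isAlpha-exists matrix₅ (from-yes (everyMinorHasOne? 2 5 matrix₅))) (m≤m+n 39 2)
alpha-bound (suc (suc (suc z))) _ =
  subst (λ m → ∃ λ a → IsAlpha k m a × 3 * a ≤ 10 * k + 21) N≡2k+1 alpha-bound-cycle
  where open CycleMatrix z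

lemma10 : (k : ℕ) → 1 ≤ k →
    ∃[ a ] (IsAlpha k (2 * k + 1) a ×
      ((k % 3 ≡ 0 → 3 * a ≤ 10 * k + 24) ×
       (k % 3 ≡ 1 → 3 * a ≤ 10 * k + 23) ×
       (k % 3 ≡ 2 → 3 * a ≤ 10 * k + 25)))
lemma10 k 1≤k with alpha-bound k 1≤k
... | a , isAlpha , bound = a , isAlpha , (λ _ → weaken 3) , (λ _ → weaken 2) , (λ _ → weaken 4)
  where
    weaken : ∀ c → 3 * a ≤ 10 * k + (21 + c)
    weaken c = ≤-trans bound (+-monoʳ-≤ (10 * k) (m≤m+n 21 c))
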